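{- Let $n\in\mathbb{N}$, $\pi=\pi_1\cdots\pi_n\in S_n$ and $k\ge0$. The subsequence of $s^k(\pi)$ consisting of the entries strictly to the right of $\pi_n$ is increasing, and all of its entries are greater than $\pi_n$.
   Context: West's stack-sorting map $s$ acts on a finite sequence of distinct integers as follows: read the input from left to right with an initially empty stack; repeatedly, if the input is nonempty and either the stack is empty or the top element of the stack is greater than the next input entry, push the next input entry onto the stack; otherwise pop the top element of the stack and append it to the output; stop when both input and stack are empty. $S_n$ is the set of permutations of $[n]$ in one-line notation. -}

module Defs where

open import Data.Nat using (ℕ; zero; suc; _<ᵇ_)
open import Data.Bool using (if_then_else_)
open import Data.List using (List; []; _∷_)

-- West's stack-sorting algorithm, literally:
-- run input stack : the output produced from the current input and stack.
run : List ℕ → List ℕ → List ℕ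
run []       []       = []
run []       (t ∷ ts) = t ∷ run [] ts
run (x ∷ xs) []       = run xs (x ∷ [])
run (x ∷ xs) (t ∷ ts) =
  if x <ᵇ t then run xs (x ∷ t ∷ ts) else t ∷ run (x ∷ xs) ts

s : List ℕ → List ℕ
s π = run π []

s^ : ℕ → List ℕ → List ℕ
s^ zero    π = π
s^ (suc k) π = s (s^ k π)

{-# OPTIONS --safe #-}
module Submission where

-- The invariant is: the list is duplicate-free and its segment starting at πₙ is
-- increasing. The stack of s is always increasing from the top. On reading πₙ, s pops
-- the smaller stack entries and pushes πₙ onto an increasing stack of larger ones;
-- every later input entry exceeds πₙ, so πₙ is output next, and the rest of the
-- output is the merge of two disjoint increasing sequences above πₙ (the remaining
-- input and the stack), hence again increasing and above πₙ.

open import Defs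
open import Data.Nat using (ℕ; zero; suc; _<_; _≤_; _<ᵇ_)
open import Data.List using (List; []; _∷_; _++_; [_]; map; upTo)
open import Data.List.Relation.Binary.Permutation.Propositional using (_↭_)
open import Data.List.Relation.Unary.All using (All)
open import Data.List.Relation.Unary.Linked using (Linked)
open import Relation.Binary.PropositionalEquality using (_≡_)
open import Data.Product using (_×_)

open import Data.Bool using (true; false)
open import Data.Empty using (⊥-elim)
open import Data.Nat.Properties
  using (<-trans; <-irrefl; <⇒≤; <⇒≱; ≤∧≢⇒<; <-≤-connex; suc-injective; <ᵇ-reflects-<)
open import Data.Product using (_,_; ∃₂)
open import Data.Sum using (inj₁; inj₂; [_,_]′)
open import Data.List.Properties using (++-assoc; ++-identityʳ; ∷-injectiveʳ)
open import Data.List.Membership.Propositional using (_∉_)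
open import Data.List.Membership.Propositional.Properties using (∈-++⁺ʳ)
open import Data.List.Relation.Unary.Any using (here; there)
open import Data.List.Relation.Unary.All using ([]; _∷_)
import Data.List.Relation.Unary.All as All
open import Data.List.Relation.Unary.AllPairs using (_∷_)
open import Data.List.Relation.Unary.Linked using ([]; [-]; _∷_; head; tail)
open import Data.List.Relation.Unary.Linked.Properties using (Linked⇒All)
open import Data.List.Relation.Unary.Unique.Propositional using (Unique)
import Data.List.Relation.Unary.Unique.Propositional.Properties as Unique
open import Data.List.Relation.Binary.Disjoint.Propositional using (Disjoint; contractₗ; contractᵣ)
open import Data.List.Relation.Binary.Permutation.Propositional
  using (prep; ↭-sym; ↭-trans; ↭⇒↭ₛ; module PermutationReasoning)
open import Data.List.Relation.Binary.Permutation.Propositional.Properties using (shift)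
open import Data.List.Relation.Binary.Permutation.Setoid.Properties using (Unique-resp-↭)
open import Relation.Binary.PropositionalEquality
  using (refl; sym; trans; cong; subst; setoid)
open import Relation.Nullary.Negation using (contradiction)
open import Relation.Nullary.Reflects using (ofʸ; ofⁿ)
open import Level using (Level)

private
  variable
    a : Level
    A : Set a

Linked-<⇒All : ∀ {x xs} → Linked _<_ (x ∷ xs) → All (x <_) xs
Linked-<⇒All [-]         = []
Linked-<⇒All (x<y ∷ lys) = Linked⇒All <-trans x<y lys

Linked-<⇒∉ : ∀ {x xs} → Linked _<_ (x ∷ xs) → x ∉ xs
Linked-<⇒∉ lxs x∈xs = <-irrefl refl (All.lookup (Linked-<⇒All lxs) x∈xs)

Linked-<-skip : ∀ {x y xs} → Linked _<_ (x ∷ y ∷ xs) → Linked _<_ (x ∷ xs)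
Linked-<-skip (_   ∷ [-])       = [-]
Linked-<-skip (x<y ∷ y<z ∷ lzs) = <-trans x<y y<z ∷ lzs

Unique-++⇒Disjoint : ∀ (xs : List A) {ys} → Unique (xs ++ ys) → Disjoint xs ys
Unique-++⇒Disjoint (x ∷ xs) (x∉ ∷ _) (here refl , v∈ys) = All.lookup x∉ (∈-++⁺ʳ xs v∈ys) refl
Unique-++⇒Disjoint (x ∷ xs) (_ ∷ u)  (there v∈xs , v∈ys) = Unique-++⇒Disjoint xs u (v∈xs , v∈ys)

Unique⇒suffix≡ : ∀ (xs xs′ : List A) {x L ys ys′} → Unique L →
                 L ≡ xs ++ x ∷ ys → L ≡ xs′ ++ x ∷ ys′ → ys ≡ ys′
Unique⇒suffix≡ []       []        _        refl refl = refl
Unique⇒suffix≡ []       (_ ∷ xs′) (x∉ ∷ _) refl refl = ⊥-elim (All.lookup x∉ (∈-++⁺ʳ xs′ (here refl)) refl)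
Unique⇒suffix≡ (_ ∷ xs) []        (x∉ ∷ _) refl refl = ⊥-elim (All.lookup x∉ (∈-++⁺ʳ xs (here refl)) refl)
Unique⇒suffix≡ (_ ∷ xs) (_ ∷ xs′) (_ ∷ u)  refl eq   = Unique⇒suffix≡ xs xs′ u refl (∷-injectiveʳ eq)

Disjoint-∷ʳ : ∀ {x : A} {xs ys} → x ∉ xs → Disjoint xs ys → Disjoint xs (x ∷ ys)
Disjoint-∷ʳ x∉xs _     (x∈xs , here refl)  = x∉xs x∈xs
Disjoint-∷ʳ _    xs#ys (v∈xs , there v∈ys) = xs#ys (v∈xs , v∈ys)

run-push : ∀ {x t} xs ts → x < t → run (x ∷ xs) (t ∷ ts) ≡ run xs (x ∷ t ∷ ts)
run-push {x} {t} _ _ x<t with x <ᵇ t | <ᵇ-reflects-< x t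
... | true  | _        = refl
... | false | ofⁿ x≮t = contradiction x<t x≮t

run-pop : ∀ {x t} xs ts → t ≤ x → run (x ∷ xs) (t ∷ ts) ≡ t ∷ run (x ∷ xs) ts
run-pop {x} {t} _ _ t≤x with x <ᵇ t | <ᵇ-reflects-< x t
... | false | _        = refl
... | true  | ofʸ x<t = contradiction t≤x (<⇒≱ x<t)

run-↭ : ∀ xs st → run xs st ↭ xs ++ st
run-↭ []       []       = _↭_.refl
run-↭ []       (t ∷ ts) = prep t (run-↭ [] ts)
run-↭ (x ∷ xs) []       = ↭-trans (run-↭ xs [ x ]) (shift x xs [])
-- Plain λs rather than `with`: the lexicographic recursion on (input, stack) is not
-- recognised through a with-function.
run-↭ (x ∷ xs) (t ∷ ts) = [
    (λ x<t → begin
      run (x ∷ xs) (t ∷ ts)  ≡⟨ run-push xs ts x<t ⟩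
      run xs (x ∷ t ∷ ts)    ↭⟨ run-↭ xs (x ∷ t ∷ ts) ⟩
      xs ++ x ∷ t ∷ ts       ↭⟨ shift x xs (t ∷ ts) ⟩
      x ∷ xs ++ t ∷ ts       ∎) ,
    (λ t≤x → begin
      run (x ∷ xs) (t ∷ ts)  ≡⟨ run-pop xs ts t≤x ⟩
      t ∷ run (x ∷ xs) ts    <⟨ run-↭ (x ∷ xs) ts ⟩
      t ∷ x ∷ xs ++ ts       ↭⟨ shift t (x ∷ xs) ts ⟨
      x ∷ xs ++ t ∷ ts       ∎)
  ]′ (<-≤-connex x t)
  where open PermutationReasoning

s-Unique : ∀ {L} → Unique L → Unique (s L)
s-Unique {L} =
  Unique-resp-↭ (setoid ℕ) (↭⇒↭ₛ (↭-sym (subst (run L [] ↭_) (++-identityʳ L) (run-↭ L []))))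

run-read : ∀ x ys st → Linked _<_ st →
           ∃₂ λ popped T → st ≡ popped ++ T ×
                           run (x ∷ ys) st ≡ popped ++ run ys (x ∷ T) ×
                           Linked _<_ (x ∷ T)
run-read x ys []       _   = [] , [] , refl , refl , [-]
run-read x ys (t ∷ ts) lst with <-≤-connex x t
... | inj₁ x<t = [] , t ∷ ts , refl , run-push ys ts x<t , x<t ∷ lst
... | inj₂ t≤x with run-read x ys ts (tail lst)
...   | popped , T , refl , eq , lxT =
  t ∷ popped , T , refl , trans (run-pop ys ts t≤x) (cong (t ∷_) eq) , lxT

run-pop-top : ∀ {p} zs T → Linked _<_ (p ∷ zs) → run zs (p ∷ T) ≡ p ∷ run zs T
run-pop-top []       T _         = refl
run-pop-top (z ∷ zs) T (p<z ∷ _) = run-pop zs T (<⇒≤ p<z)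

run-Linked : ∀ {b} zs T → Linked _<_ (b ∷ zs) → Linked _<_ (b ∷ T) → Disjoint zs T →
             Linked _<_ (b ∷ run zs T)
run-Linked []       []       _   _   _ = [-]
run-Linked []       (t ∷ ts) _   lbT _ = head lbT ∷ run-Linked [] ts [-] (tail lbT) (λ ())
run-Linked (z ∷ zs) []       lbz _   _ =
  run-Linked zs [ z ] (Linked-<-skip lbz) (head lbz ∷ [-])
    (Disjoint-∷ʳ (Linked-<⇒∉ (tail lbz)) (λ ()))
run-Linked {b} (z ∷ zs) (t ∷ ts) lbz lbT z∷zs#T = [
    (λ z<t → subst (λ o → Linked _<_ (b ∷ o)) (sym (run-push zs ts z<t))
      (run-Linked zs (z ∷ t ∷ ts) (Linked-<-skip lbz) (head lbz ∷ z<t ∷ tail lbT)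
        (Disjoint-∷ʳ (Linked-<⇒∉ (tail lbz)) (contractₗ z∷zs#T)))) ,
    (λ t≤z → subst (λ o → Linked _<_ (b ∷ o)) (sym (run-pop zs ts t≤z))
      (head lbT ∷ run-Linked (z ∷ zs) ts
        (≤∧≢⇒< t≤z (λ t≡z → z∷zs#T (here t≡z , here refl)) ∷ tail lbz)
        (tail lbT) (contractᵣ z∷zs#T)))
  ]′ (<-≤-connex z t)

IncreasingFrom : ℕ → List ℕ → Set
IncreasingFrom p L = ∃₂ λ ys zs → L ≡ ys ++ p ∷ zs × Linked _<_ (p ∷ zs)

++-IncreasingFrom : ∀ {p L} xs → IncreasingFrom p L → IncreasingFrom p (xs ++ L)
++-IncreasingFrom xs (ys , zs , refl , lpzs) = xs ++ ys , zs , sym (++-assoc xs ys _) , lpzs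

run-IncreasingFrom : ∀ {p zs} ys st → Linked _<_ st → Linked _<_ (p ∷ zs) →
                     Disjoint ys zs → Disjoint st zs →
                     IncreasingFrom p (run (ys ++ p ∷ zs) st)
run-IncreasingFrom {p} {zs} [] st lst lpzs _ st#zs with run-read p zs st lst
... | popped , T , refl , eq , lpT =
  popped , run zs T , trans eq (cong (popped ++_) (run-pop-top zs T lpzs)) ,
  run-Linked zs T lpzs lpT (λ (v∈zs , v∈T) → st#zs (∈-++⁺ʳ popped v∈T , v∈zs))
run-IncreasingFrom {p} {zs} (y ∷ ys) st lst lpzs y∷ys#zs st#zs
  with run-read y (ys ++ p ∷ zs) st lst
... | popped , T , refl , eq , lyT =
  subst (IncreasingFrom p) (sym eq) (++-IncreasingFrom popped
    (run-IncreasingFrom ys (y ∷ T) lyT lpzs (contractₗ y∷ys#zs) y∷T#zs))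
  where
  y∷T#zs : Disjoint (y ∷ T) zs
  y∷T#zs (here refl , v∈zs) = y∷ys#zs (here refl , v∈zs)
  y∷T#zs (there v∈T , v∈zs) = st#zs (∈-++⁺ʳ popped v∈T , v∈zs)

IncreasingFrom⇒Linked : ∀ {p L} ys {zs} → Unique L → IncreasingFrom p L →
                        L ≡ ys ++ p ∷ zs → Linked _<_ (p ∷ zs)
IncreasingFrom⇒Linked {p} ys u (ys₀ , zs₀ , L≡₀ , lpzs₀) L≡ =
  subst (λ zs → Linked _<_ (p ∷ zs)) (Unique⇒suffix≡ ys₀ ys u L≡₀ L≡) lpzs₀

s-IncreasingFrom : ∀ {p L} → Unique L → IncreasingFrom p L → IncreasingFrom p (s L)
s-IncreasingFrom u (ys , zs , refl , lpzs) =
  run-IncreasingFrom ys [] [] lpzs (contractᵣ (Unique-++⇒Disjoint ys u)) (λ ())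

s^-Unique : ∀ k {L} → Unique L → Unique (s^ k L)
s^-Unique zero    u = u
s^-Unique (suc k) u = s-Unique (s^-Unique k u)

s^-IncreasingFrom : ∀ k {p L} → Unique L → IncreasingFrom p L → IncreasingFrom p (s^ k L)
s^-IncreasingFrom zero    _ inc = inc
s^-IncreasingFrom (suc k) u inc = s-IncreasingFrom (s^-Unique k u) (s^-IncreasingFrom k u inc)

↭-map-suc-upTo⇒Unique : ∀ {π} n → π ↭ map suc (upTo n) → Unique π
↭-map-suc-upTo⇒Unique n π↭ =
  Unique-resp-↭ (setoid ℕ) (↭⇒↭ₛ (↭-sym π↭)) (Unique.map⁺ suc-injective (Unique.upTo⁺ n))

lemma5p1 : (n : ℕ) (π : List ℕ) (k : ℕ) (σ : List ℕ) (πₙ : ℕ) →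
    π ↭ map suc (upTo n) → π ≡ σ ++ (πₙ ∷ []) →
    (ys zs : List ℕ) → s^ k π ≡ ys ++ (πₙ ∷ zs) →
    Linked _<_ zs × All (πₙ <_) zs
lemma5p1 n π k σ πₙ π↭ π≡ ys zs sᵏπ≡ = tail lπₙzs , Linked-<⇒All lπₙzs
  where
  uπ : Unique π
  uπ = ↭-map-suc-upTo⇒Unique n π↭

  lπₙzs : Linked _<_ (πₙ ∷ zs)
  lπₙzs = IncreasingFrom⇒Linked ys (s^-Unique k uπ)
            (s^-IncreasingFrom k uπ (σ , [] , π≡ , [-])) sᵏπ≡
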